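{- Fix a finite set $S$ of first-order clauses and a depth limit $d$ (a bound on the length of tableau branches). Then the constraint-learning search procedure described in the context, run on $S$ with depth limit $d$, terminates.
   Context: Clausal connection tableau calculus (free-variable, with a single global substitution $\sigma$, input a finite set $S$ of first-order clauses without equality). Inference rules: (Start) an empty tableau is extended by attaching the literals $L_1,\dots,L_n$ of a clause $C=L_1\vee\dots\vee L_n\in S$ (variables renamed apart from the tableau) as children of the root. (Reduction) an open branch whose leaf literal $L_1$ can be made complementary to a literal $L$ on its path (i.e. $\sigma(\lnot L)=\sigma(L_1)$ after extending $\sigma$ by a unifier) is closed, extending $\sigma$ accordingly. (Extension) below the leaf literal $L$ of an open branch, the literals $L_1,\dots,L_n$ of a renamed copy of a clause $C\in S$ are attached as children, where for the connected literal $L_i$ one requires $\sigma(\lnot L)=\sigma(L_i)$ after extending $\sigma$; the branch through $L_i$ is then closed. A tableau is closed when all branches are closed. Only tableaux whose branches do not exceed the depth limit are considered. Positions: the root is the empty position, and $p.i$ is the $i$-th child of position $p$; variables are named after the position below which their clause is attached, so names are stable under backtracking. Constraint language: an atom is one of $\mathcal{S}_C$ (the tableau was started with clause $C$), $\mathcal{R}^q_p$ (a reduction from position $p$ to an ancestor position $q$), or $\mathcal{E}^C_{p/i}$ (position $p$ was extended by connecting to the $i$-th literal of clause $C$). A constraint is a finite set of atoms. Each applied inference corresponds to an atom. Reasons. Let $T$ be a tableau built by a set of inferences $I$, $B$ an open branch, and $I'\subseteq I$ the inferences needed to produce $B$ (the start step and the extensions along the path to $B$), giving sub-tableau $T'$.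 If an inference $j$ applicable to $B$ in $T'$ is not applicable in $T$, a reason for its failure is a minimal $E\subseteq I\setminus I'$ such that applying $E$ additionally to $T'$ prevents applying $j$ at $B$. If no inference $j$ among those possible at $B$ in $T'$ can be applied in $T$, a reason that $T$ is stuck is $I'\cup\bigcup_j R_j$, where $R_j$ is a failure reason for $j$ as just defined if the calculus prevents $j$, and $R_j=R'\setminus\{j\}$ if $j$ is prevented because it would complete a previously learned constraint $R'$ (i.e. $j$ leads to a tableau already known to be stuck with reason $R'$). Search procedure. Maintain the current tableau $T$ (with $\sigma$), a set of learned constraints (initially empty), and a trail (stack) of atoms of the inferences currently applied (initially empty). A constraint is violated by the trail if all of its atoms are on the trail. Repeat: select an open branch $B$ (for the empty tableau, choose a start clause); initialise a candidate constraint learn to $I'$ for $B$; for each possible inference $j$ at $B$: if $j$ cannot be applied in the calculus, add a failure reason for $j$ to learn; else if some learned constraint $C\cup\{j\}$ is violated by $j$ together with the trail, add $C$ to learn; otherwise apply $j$, push its atom onto the trail, and proceed to the next iteration. If no inference succeeded, pop atoms from the trail (undoing the corresponding inferences) until learn is no longer violated, and record learn as a learned constraint. Stop when $T$ is closed (success) or when the learned constraint is empty (no closed tableau within the depth limit). Learned constraints are never forgotten within one depth limit. -}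

module Defs where

open import Data.Nat using (ℕ; zero; suc; _<_; _≤_)
open import Data.List using (List; []; _∷_; _++_; length; drop)
open import Data.List.Membership.Propositional using (_∈_)
open import Data.Bool using (Bool; not)
open import Data.Maybe using (Maybe; just; nothing)
open import Data.Product using (Σ; ∃; _×_; _,_)
open import Data.Sum using (_⊎_)
open import Data.Empty using (⊥)
open import Data.Unit using (⊤)
open import Relation.Binary.PropositionalEquality using (_≡_; _≢_)
open import Relation.Nullary using (¬_)

-- First-order syntax (no equality).  Function and predicate symbols are
-- named by natural numbers; V is the type of variables.

data Term (V : Set) : Set where
  var : V → Term V
  fun : ℕ → List (Term V) → Term V

record Literal (V : Set) : Set where
  constructor lit
  field
    sign : Bool          -- true = positive literal
    pred : ℕ
    args : List (Term V)

-- Input clauses use variables named by ℕ; a clause is the list of its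
-- literals L₁ ∨ … ∨ Lₙ; S is a finite set (list) of clauses.
Clause : Set
Clause = List (Literal ℕ)

ClauseSet : Set
ClauseSet = List Clause

-- Tableau positions, stored REVERSED: [] is the root and (i ∷ p) is the
-- position p.i (the i-th child of p, children counted from 0).
Pos : Set
Pos = List ℕ

-- Tableau variables: variable n of the clause copy attached below position p.
Var : Set
Var = Pos × ℕ

Subst : Set
Subst = Var → Term Var

mutual
  substT : {V W : Set} → (V → Term W) → Term V → Term W
  substT σ (var x)    = σ x
  substT σ (fun f ts) = fun f (substTs σ ts)

  substTs : {V W : Set} → (V → Term W) → List (Term V) → List (Term W)
  substTs σ []       = []
  substTs σ (t ∷ ts) = substT σ t ∷ substTs σ ts

substLit : {V W : Set} → (V → Term W) → Literal V → Literal W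
substLit σ (lit s P ts) = lit s P (substTs σ ts)

negLit : {V : Set} → Literal V → Literal V
negLit (lit s P ts) = lit (not s) P ts

rename : Pos → Literal ℕ → Literal Var
rename p = substLit (λ n → var (p , n))

nth : {A : Set} → List A → ℕ → Maybe A
nth []       _       = nothing
nth (x ∷ xs) zero    = just x
nth (x ∷ xs) (suc n) = nth xs n

-- Constraint atoms (= inferences)

data Atom : Set where
  start : ℕ → Atom                 -- S_C          (C = index of clause in S)
  red   : Pos → Pos → Atom         -- red p q = R^q_p (reduction from p to ancestor q)
  ext   : ℕ → Pos → ℕ → Atom       -- ext C p i = E^C_{p/i}

Trail : Set
Trail = List Atom

Constraint : Set
Constraint = List Atom

ProperAnc : Pos → Pos → Set
ProperAnc q p = Σ Pos λ ys → ys ≢ [] × p ≡ ys ++ q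

Violated : Constraint → Trail → Set
Violated L tr = ∀ a → a ∈ L → a ∈ tr

data State : Set where
  running : Trail → List Constraint → State
  halted  : State                             -- stopped: empty constraint learned

initial : State
initial = running [] []

module Search (S : ClauseSet) (d : ℕ) where

  -- literal at a position of the tableau built by the inferences in T
  data LitAt (T : Trail) : Pos → Literal Var → Set where
    root-child : ∀ {C cl k L} → start C ∈ T → nth S C ≡ just cl →
                 nth cl k ≡ just L → LitAt T (k ∷ []) (rename [] L)
    ext-child  : ∀ {p M C i cl k L} → LitAt T p M → ext C p i ∈ T →
                 nth S C ≡ just cl → nth cl k ≡ just L →
                 LitAt T (k ∷ p) (rename p L)

  -- the unification condition contributed by an inference under σ
  -- (literals are looked up in the tableau built by T)
  EqHolds : Trail → Subst → Atom → Set
  EqHolds T σ (start C)   = ⊤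
  EqHolds T σ (red p q)   =
    ∃ λ L₁ → ∃ λ L → LitAt T p L₁ × LitAt T q L ×
      substLit σ (negLit L) ≡ substLit σ L₁
  EqHolds T σ (ext C p i) =
    ∃ λ L → ∃ λ cl → ∃ λ Lᵢ → LitAt T p L × nth S C ≡ just cl ×
      nth cl i ≡ just Lᵢ × substLit σ (negLit L) ≡ substLit σ (rename p Lᵢ)

  AtomSet : Set₁
  AtomSet = Atom → Set

  Unifiable : Trail → AtomSet → Set
  Unifiable T A = ∃ λ (σ : Subst) → ∀ a → A a → EqHolds T σ a

  DepthOK : Atom → Set
  DepthOK (start C)   = 1 ≤ d
  DepthOK (red p q)   = ⊤
  DepthOK (ext C p i) = suc (length p) ≤ d

  Applicable : Trail → AtomSet → Atom → Set
  Applicable T A j = DepthOK j × Unifiable T (λ a → a ≡ j ⊎ A a)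

  -- I' for the branch ending at p: start step and extensions along the path
  OnPathAtom : Pos → Atom → Set
  OnPathAtom p (start C)   = p ≢ []
  OnPathAtom p (red _ _)   = ⊥
  OnPathAtom p (ext C q i) = ProperAnc q p × q ≢ []

  OnPath : Trail → Pos → AtomSet
  OnPath T p a = a ∈ T × OnPathAtom p a

  OpenLeaf : Trail → Pos → Set
  OpenLeaf T p =
    (∃ λ L → LitAt T p L) ×
    (∀ C i → ¬ ext C p i ∈ T) ×
    (∀ q → ¬ red p q ∈ T) ×
    (∀ k p' → p ≡ k ∷ p' → ∀ C → ¬ ext C p' k ∈ T)

  Closed : Trail → Set
  Closed T = (∃ λ C → start C ∈ T) × (∀ p → ¬ OpenLeaf T p)

  Selected : Trail → Pos → Set
  Selected T p = (T ≡ [] × p ≡ []) ⊎ OpenLeaf T p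

  data Possible : Pos → Atom → Set where
    pos-start : ∀ {C} → C < length S → Possible [] (start C)
    pos-red   : ∀ {p q} → ProperAnc q p → q ≢ [] → Possible p (red p q)
    pos-ext   : ∀ {p C cl i} → p ≢ [] → nth S C ≡ just cl → i < length cl →
                Possible p (ext C p i)

  Blocked : List Constraint → Trail → Atom → Set
  Blocked Ls T j = ∃ λ L → L ∈ Ls × j ∈ L × Violated L (j ∷ T)

  -- E is a failure reason for j at branch p: a minimal E ⊆ I ∖ I' such that
  -- I' ∪ E prevents j
  FailureReason : Trail → Pos → Atom → Constraint → Set
  FailureReason T p j E =
    (∀ a → a ∈ E → a ∈ T × ¬ OnPath T p a) ×
    ¬ Applicable T (λ a → OnPath T p a ⊎ a ∈ E) j ×
    (∀ E' → (∀ a → a ∈ E' → a ∈ E) → ¬ (∀ a → a ∈ E → a ∈ E') →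
       Applicable T (λ a → OnPath T p a ⊎ a ∈ E') j)

  -- R is the set added to learn for a possible inference j
  ReasonFor : List Constraint → Trail → Pos → Atom → Constraint → Set
  ReasonFor Ls T p j R =
    (¬ Applicable T (_∈ T) j × FailureReason T p j R) ⊎
    (Applicable T (_∈ T) j ×
      ∃ λ L → L ∈ Ls × j ∈ L × Violated L (j ∷ T) ×
        (∀ a → a ∈ R → a ∈ L × a ≢ j) × (∀ a → a ∈ L → a ≢ j → a ∈ R))

  -- learn = I' ∪ ⋃_j R_j
  LearnIs : Trail → Pos → (Atom → Constraint) → Constraint → Set
  LearnIs T p R learn =
    (∀ a → a ∈ learn → OnPath T p a ⊎ ∃ λ j → Possible p j × a ∈ R j) ×
    (∀ a → OnPath T p a ⊎ (∃ λ j → Possible p j × a ∈ R j) → a ∈ learn)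

  PopTo : Constraint → Trail → Trail → Set
  PopTo learn T T' = ∃ λ k → T' ≡ drop k T × ¬ Violated learn T' ×
                             (∀ m → m < k → Violated learn (drop m T))

  -- one iteration of the search loop (nondeterministic in the choice of the
  -- branch, of the inference applied, and of the reasons)
  data Step : State → State → Set where
    apply     : ∀ {T Ls p j} → ¬ Closed T → Selected T p → Possible p j →
                Applicable T (_∈ T) j → ¬ Blocked Ls T j →
                Step (running T Ls) (running (j ∷ T) Ls)
    learnStop : ∀ {T Ls p} (R : Atom → Constraint) → ¬ Closed T → Selected T p →
                (∀ j → Possible p j → ReasonFor Ls T p j (R j)) →
                LearnIs T p R [] →
                Step (running T Ls) halted
    learnPop  : ∀ {T Ls p learn T'} (R : Atom → Constraint) → ¬ Closed T →
                Selected T p →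
                (∀ j → Possible p j → ReasonFor Ls T p j (R j)) →
                LearnIs T p R learn → learn ≢ [] → PopTo learn T T' →
                Step (running T Ls) (running T' (learn ∷ Ls))

  -- "s' comes after s"
  Next : State → State → Set
  Next s' s = Step s s'

-- Every atom that can ever be on the trail lies in a finite universe: positions are bounded in
-- length by the depth limit and in their entries by the length of the longest clause.  Applying an
-- inference pushes an atom of the universe that is not yet on the trail.  Learning records a
-- subset of the trail as a constraint, and since no learned constraint is ever violated by the
-- trail, the set of universe atoms on the trail was covered by no earlier constraint but is
-- covered by the new one.  So each step decreases, lexicographically, the number of subsets of the
-- universe not covered by a learned constraint and the number of universe atoms off the trail.

module Submission where

open import Defs
open import Data.Nat using (ℕ; zero; suc; _<_; _≤_; _⊔_; z≤n; s≤s; _≟_)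
open import Data.Nat.Properties using (≤-trans; m≤m⊔n; m≤n⊔m; n≤1+n; ≤∧≢⇒<)
open import Data.Nat.Induction using (<-wellFounded)
open import Data.List using (List; []; _∷_; _++_; length; map; filter; upTo; drop;
  cartesianProduct; cartesianProductWith)
open import Data.List.Properties using (≡-dec)
open import Data.List.Membership.Propositional using (_∈_; _∉_; find)
open import Data.List.Membership.Propositional.Properties
  using (∈-map⁺; ∈-++⁺ˡ; ∈-++⁺ʳ; ∈-upTo⁺; ∈-filter⁺; ∈-filter⁻; ∈-cartesianProductWith⁺;
         ∈-cartesianProduct⁺)
open import Data.List.Membership.DecPropositional using () renaming (_∈?_ to ∈?-with)
open import Data.List.Relation.Unary.All using (All; []; _∷_; all?)
import Data.List.Relation.Unary.All as All
open import Data.List.Relation.Unary.Any using (Any; here; there; any?)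
import Data.List.Relation.Binary.Sublist.Propositional as Sublist
import Data.List.Relation.Binary.Sublist.Propositional.Properties as Sublist
open import Data.List.Relation.Binary.Equality.Propositional using (≋⇒≡)
open import Data.Maybe using (just)
open import Data.Product using (_×_; _,_; proj₁; proj₂; uncurry)
open import Data.Sum using (inj₁; inj₂)
open import Data.Bool using (true; false)
open import Data.Empty using (⊥-elim)
open import Function using (_∘_)
open import Induction.WellFounded using (Acc; acc)
open import Level using (0ℓ)
open import Relation.Binary.Definitions using (DecidableEquality)
open import Relation.Binary.PropositionalEquality using (_≡_; _≢_; refl; sym; cong; subst)
open import Relation.Nullary using (¬_; Dec; yes; no; ¬?; does)
open import Relation.Nullary.Decidable using (map′; _×-dec_)
open import Relation.Unary using (Pred; Decidable; _⊆_)

module _ {A : Set} {P Q : Pred A 0ℓ} (P? : Decidable P) (Q? : Decidable Q) where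

  -- filter Q? xs is a sublist of filter P? xs; of equal length they would coincide, but only
  -- the latter contains y.
  length-filter-< : Q ⊆ P → ∀ xs {y} → y ∈ xs → P y → ¬ Q y →
                    length (filter Q? xs) < length (filter P? xs)
  length-filter-< Q⊆P xs y∈xs Py ¬Qy = ≤∧≢⇒< (Sublist.length-mono-≤ sub) lengths-differ
    where
    sub : filter Q? xs Sublist.⊆ filter P? xs
    sub = Sublist.filter⁺ Q? P? {as = xs} {bs = xs} (λ { refl → Q⊆P }) Sublist.⊆-refl

    lengths-differ : length (filter Q? xs) ≢ length (filter P? xs)
    lengths-differ eq = ¬Qy (proj₂ (∈-filter⁻ Q? {xs = xs} (subst (_ ∈_) filterP≡filterQ
                                                                  (∈-filter⁺ P? y∈xs Py))))
      where
      filterP≡filterQ : filter P? xs ≡ filter Q? xs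
      filterP≡filterQ = sym (≋⇒≡ (Sublist.to-≋ eq sub))

sublists : {A : Set} → List A → List (List A)
sublists []       = [] ∷ []
sublists (x ∷ xs) = sublists xs ++ map (x ∷_) (sublists xs)

filter∈sublists : {A : Set} {P : Pred A 0ℓ} (P? : Decidable P) (xs : List A) →
                  filter P? xs ∈ sublists xs
filter∈sublists P? []       = here refl
filter∈sublists P? (x ∷ xs) with does (P? x)
... | true  = ∈-++⁺ʳ (sublists xs) (∈-map⁺ (x ∷_) (filter∈sublists P? xs))
... | false = ∈-++⁺ˡ (filter∈sublists P? xs)

nth-just⇒<-length : {A : Set} (xs : List A) {i : ℕ} {x : A} → nth xs i ≡ just x → i < length xs
nth-just⇒<-length (_ ∷ _)  {zero}  _  = s≤s z≤n
nth-just⇒<-length (_ ∷ xs) {suc i} eq = s≤s (nth-just⇒<-length xs eq)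

maxLength : ClauseSet → ℕ
maxLength []       = 0
maxLength (c ∷ cs) = length c ⊔ maxLength cs

nth-just⇒length≤maxLength : (cs : ClauseSet) {C : ℕ} {cl : Clause} →
                            nth cs C ≡ just cl → length cl ≤ maxLength cs
nth-just⇒length≤maxLength (c ∷ cs) {zero}  refl = m≤m⊔n (length c) (maxLength cs)
nth-just⇒length≤maxLength (c ∷ cs) {suc C} eq   =
  ≤-trans (nth-just⇒length≤maxLength cs eq) (m≤n⊔m (length c) (maxLength cs))

_≟ₚ_ : DecidableEquality Pos
_≟ₚ_ = ≡-dec _≟_

_≟ₐ_ : DecidableEquality Atom
start C   ≟ₐ start C′    = map′ (cong start) (λ { refl → refl }) (C ≟ C′)
red p q   ≟ₐ red p′ q′   = map′ (λ { (refl , refl) → refl }) (λ { refl → refl , refl })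
                                 (p ≟ₚ p′ ×-dec q ≟ₚ q′)
ext C p i ≟ₐ ext C′ p′ i′ = map′ (λ { (refl , refl , refl) → refl })
                                 (λ { refl → refl , refl , refl })
                                 (C ≟ C′ ×-dec p ≟ₚ p′ ×-dec i ≟ i′)
start _   ≟ₐ red _ _     = no λ ()
start _   ≟ₐ ext _ _ _   = no λ ()
red _ _   ≟ₐ start _     = no λ ()
red _ _   ≟ₐ ext _ _ _   = no λ ()
ext _ _ _ ≟ₐ start _     = no λ ()
ext _ _ _ ≟ₐ red _ _     = no λ ()

_∈?_ : (a : Atom) (as : List Atom) → Dec (a ∈ as)
_∈?_ = ∈?-with _≟ₐ_

positions : ℕ → ℕ → List Pos
positions m zero    = [] ∷ []
positions m (suc n) = [] ∷ cartesianProductWith _∷_ (upTo m) (positions m n)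

∈-positions : ∀ m n {p} → length p ≤ n → All (_< m) p → p ∈ positions m n
∈-positions m zero    {[]}    _         _          = here refl
∈-positions m (suc n) {[]}    _         _          = here refl
∈-positions m (suc n) {k ∷ p} (s≤s |p|≤n) (k<m ∷ p<m) =
  there (∈-cartesianProductWith⁺ _∷_ (∈-upTo⁺ k<m) (∈-positions m n |p|≤n p<m))

module Termination (S : ClauseSet) (d : ℕ) where
  open Search S d

  BoundedPos : Pos → Set
  BoundedPos p = length p ≤ d × All (_< maxLength S) p

  BoundedAtom : Atom → Set
  BoundedAtom (start C)   = C < length S × 1 ≤ d
  BoundedAtom (red p q)   = BoundedPos p × BoundedPos q
  BoundedAtom (ext C p i) = C < length S × BoundedPos (i ∷ p)

  boundedPositions : List Pos
  boundedPositions = positions (maxLength S) d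

  startAtoms redAtoms extAtoms boundedAtoms : List Atom
  startAtoms   = map start (upTo (length S))
  redAtoms     = cartesianProductWith red boundedPositions boundedPositions
  extAtoms     = cartesianProductWith (uncurry ext)
                   (cartesianProduct (upTo (length S)) boundedPositions) (upTo (maxLength S))
  boundedAtoms = startAtoms ++ redAtoms ++ extAtoms

  BoundedPos⇒∈boundedPositions : ∀ {p} → BoundedPos p → p ∈ boundedPositions
  BoundedPos⇒∈boundedPositions (|p|≤d , p<m) = ∈-positions (maxLength S) d |p|≤d p<m

  BoundedAtom⇒∈boundedAtoms : ∀ {a} → BoundedAtom a → a ∈ boundedAtoms
  BoundedAtom⇒∈boundedAtoms {start C} (C<s , _) = ∈-++⁺ˡ (∈-map⁺ start (∈-upTo⁺ C<s))
  BoundedAtom⇒∈boundedAtoms {red p q} (bp , bq) =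
    ∈-++⁺ʳ startAtoms (∈-++⁺ˡ
      (∈-cartesianProductWith⁺ red (BoundedPos⇒∈boundedPositions bp)
                                   (BoundedPos⇒∈boundedPositions bq)))
  BoundedAtom⇒∈boundedAtoms {ext C p i} (C<s , 1+|p|≤d , i<m ∷ p<m) =
    ∈-++⁺ʳ startAtoms (∈-++⁺ʳ redAtoms
      (∈-cartesianProductWith⁺ (uncurry ext)
        (∈-cartesianProduct⁺ (∈-upTo⁺ C<s)
                             (BoundedPos⇒∈boundedPositions (≤-trans (n≤1+n _) 1+|p|≤d , p<m)))
        (∈-upTo⁺ i<m)))

  BoundedTrail : Trail → Set
  BoundedTrail T = ∀ {a} → a ∈ T → BoundedAtom a

  literal-index<maxLength : ∀ {C cl k L} → nth S C ≡ just cl → nth cl k ≡ just L → k < maxLength S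
  literal-index<maxLength {cl = cl} S[C] cl[k] =
    ≤-trans (nth-just⇒<-length cl cl[k]) (nth-just⇒length≤maxLength S S[C])

  LitAt⇒BoundedPos : ∀ {T p L} → BoundedTrail T → LitAt T p L → BoundedPos p
  LitAt⇒BoundedPos bounded (root-child start∈T S[C] cl[k]) =
    proj₂ (bounded start∈T) , literal-index<maxLength S[C] cl[k] ∷ []
  LitAt⇒BoundedPos bounded (ext-child _ ext∈T S[C] cl[k])
    with _ , 1+|p|≤d , _ ∷ p<m ← bounded ext∈T =
    1+|p|≤d , literal-index<maxLength S[C] cl[k] ∷ p<m

  applicable⇒BoundedAtom : ∀ {T p j} → BoundedTrail T → Possible p j → Applicable T (_∈ T) j →
                           BoundedAtom j
  applicable⇒BoundedAtom bounded (pos-start C<s) (1≤d , _) = C<s , 1≤d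
  applicable⇒BoundedAtom bounded (pos-red _ _) (_ , _ , eqs)
    with _ , _ , litP , litQ , _ ← eqs _ (inj₁ refl) =
    LitAt⇒BoundedPos bounded litP , LitAt⇒BoundedPos bounded litQ
  applicable⇒BoundedAtom bounded (pos-ext _ S[C] i<|cl|) (1+|p|≤d , _ , eqs)
    with _ , _ , _ , litP , _ ← eqs _ (inj₁ refl) =
    nth-just⇒<-length S S[C] ,
    1+|p|≤d ,
    ≤-trans i<|cl| (nth-just⇒length≤maxLength S S[C]) ∷ proj₂ (LitAt⇒BoundedPos bounded litP)

  selected-possible⇒∉ : ∀ {T p j} → Selected T p → Possible p j → j ∉ T
  selected-possible⇒∉ (inj₁ (refl , _))            _             ()
  selected-possible⇒∉ (inj₂ ((_ , ()) , _))         (pos-start _)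
  selected-possible⇒∉ (inj₂ (_ , _ , no-red , _))   (pos-red _ _)   = no-red _
  selected-possible⇒∉ (inj₂ (_ , no-ext , _))       (pos-ext _ _ _) = no-ext _ _

  learned⊆trail : ∀ {Ls T p R learn} → (∀ j → Possible p j → ReasonFor Ls T p j (R j)) →
                  LearnIs T p R learn → ∀ {a} → a ∈ learn → a ∈ T
  learned⊆trail reasons (⊆-onPath-reasons , _) a∈learn with ⊆-onPath-reasons _ a∈learn
  ... | inj₁ (a∈T , _)       = a∈T
  ... | inj₂ (j , pos , a∈R) with reasons j pos
  ...   | inj₁ (_ , E⊆trail , _) = proj₁ (E⊆trail _ a∈R)
  ...   | inj₂ (_ , L , _ , _ , L⊆j∷T , R⊆L-j , _) with R⊆L-j _ a∈R
  ...     | a∈L , a≢j with L⊆j∷T _ a∈L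
  ...       | here a≡j = ⊥-elim (a≢j a≡j)
  ...       | there a∈T = a∈T

  NoneViolated : List Constraint → Trail → Set
  NoneViolated Ls T = ∀ {L} → L ∈ Ls → ¬ Violated L T

  unblocked-preserves-NoneViolated : ∀ {Ls T j} → ¬ Blocked Ls T j → NoneViolated Ls T →
                                     NoneViolated Ls (j ∷ T)
  unblocked-preserves-NoneViolated {T = T} {j = j} unblocked none {L} L∈Ls L⊆j∷T with j ∈? L
  ... | yes j∈L = unblocked (L , L∈Ls , j∈L , L⊆j∷T)
  ... | no  j∉L = none L∈Ls λ a a∈L → ∈-tail a∈L (L⊆j∷T a a∈L)
    where
    ∈-tail : ∀ {a} → a ∈ L → a ∈ j ∷ T → a ∈ T
    ∈-tail a∈L (here refl) = ⊥-elim (j∉L a∈L)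
    ∈-tail _   (there a∈T) = a∈T

  Invariant : Trail → List Constraint → Set
  Invariant T Ls = BoundedTrail T × NoneViolated Ls T

  offTrail : Trail → ℕ
  offTrail T = length (filter (λ a → ¬? (a ∈? T)) boundedAtoms)

  offTrail-∷ : ∀ {T j} → BoundedAtom j → j ∉ T → offTrail (j ∷ T) < offTrail T
  offTrail-∷ bj j∉T =
    length-filter-< _ _ (_∘ there) boundedAtoms (BoundedAtom⇒∈boundedAtoms bj) j∉T
                    (λ j∉j∷T → j∉j∷T (here refl))

  Covered : List Constraint → List Atom → Set
  Covered Ls X = Any (All (_∈ X)) Ls

  covered? : ∀ Ls X → Dec (Covered Ls X)
  covered? Ls X = any? (all? (_∈? X)) Ls

  uncovered : List Constraint → ℕ
  uncovered Ls = length (filter (¬? ∘ covered? Ls) (sublists boundedAtoms))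

  uncovered-∷ : ∀ {T Ls learn} → Invariant T Ls → (∀ {a} → a ∈ learn → a ∈ T) →
                uncovered (learn ∷ Ls) < uncovered Ls
  uncovered-∷ {T} {Ls} {learn} (bounded , none) learn⊆T =
    length-filter-< _ _ (λ ¬covered covered → ¬covered (there covered)) (sublists boundedAtoms)
      (filter∈sublists (_∈? T) boundedAtoms) trail-uncovered trail-covered-by-learn
    where
    onTrail : List Atom
    onTrail = filter (_∈? T) boundedAtoms

    trail-uncovered : ¬ Covered Ls onTrail
    trail-uncovered covered with L , L∈Ls , L⊆onTrail ← find covered =
      none L∈Ls λ a a∈L → proj₂ (∈-filter⁻ (_∈? T) {xs = boundedAtoms} (All.lookup L⊆onTrail a∈L))

    trail-covered-by-learn : ¬ ¬ Covered (learn ∷ Ls) onTrail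
    trail-covered-by-learn ¬covered = ¬covered (here (All.tabulate λ a∈learn →
      ∈-filter⁺ (_∈? T) (BoundedAtom⇒∈boundedAtoms (bounded (learn⊆T a∈learn))) (learn⊆T a∈learn)))

  push-preserves-Invariant : ∀ {T Ls j} → BoundedAtom j → ¬ Blocked Ls T j → Invariant T Ls →
                             Invariant (j ∷ T) Ls
  push-preserves-Invariant bj unblocked (bounded , none) =
    (λ { (here refl) → bj ; (there a∈T) → bounded a∈T }) ,
    unblocked-preserves-NoneViolated unblocked none

  pop-preserves-Invariant : ∀ {T Ls learn} k → ¬ Violated learn (drop k T) → Invariant T Ls →
                            Invariant (drop k T) (learn ∷ Ls)
  pop-preserves-Invariant {T} k ¬violated (bounded , none) =
    bounded ∘ drop⊆T ,
    λ { (here refl)  → ¬violated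
      ; (there L∈Ls) L⊆drop → none L∈Ls λ a a∈L → drop⊆T (L⊆drop a a∈L) }
    where
    drop⊆T : ∀ {a} → a ∈ drop k T → a ∈ T
    drop⊆T = Sublist.lookup (Sublist.drop-⊆ k T)

  acc-running : ∀ Ls → Acc _<_ (uncovered Ls) → ∀ T → Acc _<_ (offTrail T) → Invariant T Ls →
                Acc Next (running T Ls)
  acc-step : ∀ Ls → Acc _<_ (uncovered Ls) → ∀ T → (∀ {n} → n < offTrail T → Acc _<_ n) →
             Invariant T Ls → ∀ {s} → Step (running T Ls) s → Acc Next s

  acc-running Ls accU T (acc accO) inv = acc (acc-step Ls accU T accO inv)

  acc-step Ls accU T accO inv@(bounded , _)
           (apply {j = j} _ selected possible applicable unblocked) =
    acc-running Ls accU (j ∷ T) (accO (offTrail-∷ bj (selected-possible⇒∉ selected possible)))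
      (push-preserves-Invariant bj unblocked inv)
    where
    bj : BoundedAtom j
    bj = applicable⇒BoundedAtom bounded possible applicable
  acc-step Ls accU T accO inv (learnStop _ _ _ _ _) = acc λ ()
  acc-step Ls (acc accU) T accO inv
           (learnPop {learn = learn} _ _ _ reasons learnIs _ (k , refl , ¬violated , _)) =
    acc-running (learn ∷ Ls) (accU (uncovered-∷ inv (learned⊆trail reasons learnIs)))
      (drop k T) (<-wellFounded _) (pop-preserves-Invariant k ¬violated inv)

lemma1 : (S : ClauseSet) (d : ℕ) → Acc (Search.Next S d) initial
lemma1 S d = acc-running [] (<-wellFounded _) [] (<-wellFounded _) ((λ ()) , λ ())
  where open Termination S d
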